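{- Let $S\subseteq\mathbb{Z}^+$, let $n,k,r\ge 0$ be integers and let $\ell$ be an integer with $0\le\ell\le r$. Then $$ {n\brace k}_{S,r}=\ell!\sum_{j=0}^n\binom{n}{j}{j\brace k}_{S,r-\ell}{n-j\brace \ell}_{S-\vec{1}}=\sum_{j=0}^n\binom{n}{j}{j\brace k}_{S,r-\ell}{n-j\brace 0}_{S,\ell}. $$
   Context: For $S\subseteq\mathbb{Z}^+$ and integers $n,k,r\ge0$, ${n\brace k}_{S,r}$ is the number of set partitions of $[n+r]$ into $k+r$ non-empty blocks such that $1,\dots,r$ lie in distinct blocks and every block has cardinality in $S$; equivalently $\sum_{n\ge0}{n\brace k}_{S,r}\frac{x^n}{n!}=\frac{1}{k!}\Big(\sum_{s\in S}\frac{x^{s-1}}{(s-1)!}\Big)^r\Big(\sum_{s\in S}\frac{x^s}{s!}\Big)^k$. $S-\vec{1}=\{s-1: s\in S\}$ (which may contain $0$), and for a set $T$ of non-negative integers ${m\brace \ell}_T$ is defined by $\sum_{m\ge0}{m\brace \ell}_T\frac{x^m}{m!}=\frac{1}{\ell!}\Big(\sum_{t\in T}\frac{x^t}{t!}\Big)^\ell$ (for $0\notin T$ this is the number of partitions of $[m]$ into $\ell$ blocks with sizes in $T$). -}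

module Defs where

open import Data.Bool using (Bool; true; false; if_then_else_)
open import Data.Nat using (ℕ; zero; suc; _∸_) renaming (_+_ to _+ℕ_; _*_ to _*ℕ_)
open import Data.Nat.Properties using (_!≢0)
open import Data.Nat.Base using (_!)
open import Data.Nat.Combinatorics using (_C_)
open import Data.Integer using (+_)
open import Data.Rational using (ℚ; _/_; 0ℚ) renaming (_+_ to _+ℚ_)

Subset : Set
Subset = ℕ → Bool

[_∈_] : ℕ → Subset → ℕ
[ m ∈ S ] = if S m then 1 else 0

-- S - 1 = { s - 1 : s ∈ S }  (for S ⊆ ℤ⁺)
_-𝟙 : Subset → Subset
(S -𝟙) t = S (suc t)

Σℕ[≤_] : ℕ → (ℕ → ℕ) → ℕ
Σℕ[≤ zero ] f = f 0
Σℕ[≤ suc n ] f = Σℕ[≤ n ] f +ℕ f (suc n)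

Σℚ[≤_] : ℕ → (ℕ → ℚ) → ℚ
Σℚ[≤ zero ] f = f 0
Σℚ[≤ suc n ] f = Σℚ[≤ n ] f +ℚ f (suc n)

-- Sequences a m = m! [x^m] A(x)  (exponential generating function coefficients).
-- Product of EGFs: (n! [x^n]) (A B) = Σ_j C(n,j) a_j b_{n-j}.
egf* : (ℕ → ℕ) → (ℕ → ℕ) → ℕ → ℕ
egf* a b n = Σℕ[≤ n ] (λ j → (n C j) *ℕ (a j *ℕ b (n ∸ j)))

egf1 : ℕ → ℕ
egf1 zero = 1
egf1 (suc _) = 0

egf^ : (ℕ → ℕ) → ℕ → ℕ → ℕ
egf^ a zero = egf1
egf^ a (suc i) = egf* a (egf^ a i)

-- Σ_{t ∈ T} x^t / t!   (coefficient sequence)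
egfSet : Subset → ℕ → ℕ
egfSet T m = [ m ∈ T ]

-- Σ_{s ∈ S} x^(s-1) / (s-1)!  (coefficient sequence)
egfSetShift : Subset → ℕ → ℕ
egfSetShift S m = [ suc m ∈ S ]

-- {m brace ℓ}_T  :  Σ_m {m brace ℓ}_T x^m/m! = (1/ℓ!) (Σ_{t∈T} x^t/t!)^ℓ
-- (rational in general, since 0 ∈ T is allowed)
braceT : ℕ → ℕ → Subset → ℚ
braceT m ℓ T = (+ egf^ (egfSet T) ℓ m) / (ℓ !)
  where instance _ = ℓ !≢0

-- {n brace k}_{S,r} : Σ_n {n brace k}_{S,r} x^n/n!
--   = (1/k!) (Σ_{s∈S} x^(s-1)/(s-1)!)^r (Σ_{s∈S} x^s/s!)^k
braceSr : ℕ → ℕ → Subset → ℕ → ℚ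
braceSr n k S r = (+ egf* (egf^ (egfSetShift S) r) (egf^ (egfSet S) k) n) / (k !)
  where instance _ = k !≢0

ℕ→ℚ : ℕ → ℚ
ℕ→ℚ m = (+ m) / 1

module Submission where

-- Write A(x) = Σ_{s∈S} x^(s-1)/(s-1)! and B(x) = Σ_{s∈S} x^s/s!,
-- so that k! Σ_n {n brace k}_{S,r} x^n/n! = A^r B^k.  Since ℓ ≤ r,
--   A^r B^k = (A^(r-ℓ) B^k) · A^ℓ,
-- and reading off n! [x^n] of the right-hand side by the binomial product
-- rule for exponential generating functions gives both identities:
-- A^(r-ℓ) B^k / k! generates {j brace k}_{S,r-ℓ}, while A^ℓ / ℓ! generates
-- {m brace ℓ}_{S-1} and A^ℓ itself generates {m brace 0}_{S,ℓ}.

open import Defs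
open import Data.Bool using (false)
open import Data.Nat using (ℕ; _≤_; _∸_) renaming (_*_ to _*ℕ_)
open import Data.Nat.Base using (_!)
open import Data.Nat.Combinatorics using (_C_)
open import Data.Rational using (ℚ; _*_)
open import Data.Product using (_×_)
open import Relation.Binary.PropositionalEquality using (_≡_)

open import Data.Nat using (zero; suc; z≤n; NonZero) renaming (_+_ to _+ℕ_)
import Data.Nat.Properties as ℕP
open import Algebra.Properties.CommutativeSemigroup ℕP.+-commutativeSemigroup using () renaming (interchange to +-interchange; x∙yz≈y∙xz to +-x∙yz≈y∙xz)
open import Data.Nat.Combinatorics using (k>n⇒nCk≡0; nCk+nC[k+1]≡[n+1]C[k+1])
open import Data.Nat.Solver using (module +-*-Solver)
open import Data.Product using (_,_)
open import Data.Empty using (⊥-elim-irr)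
open import Data.Integer using (+_)
import Data.Integer as ℤ
import Data.Integer.Properties as ℤP
open import Data.Rational using (_/_; 1ℚ; toℚᵘ) renaming (_+_ to _+ℚ_)
import Data.Rational.Properties as ℚP
open import Data.Rational.Unnormalised using (ℚᵘ; mkℚᵘ; *≡*) renaming (_≃_ to _≃ᵘ_; _+_ to _+ᵘ_; _*_ to _*ᵘ_)
import Data.Rational.Unnormalised.Properties as ℚᵘP
import Data.Integer.Solver as ℤSolver
import Data.Rational.Solver as ℚSolver
open import Relation.Binary.PropositionalEquality using (refl; sym; trans; cong; cong₂; module ≡-Reasoning)

open ≡-Reasoning

Σℕ-cong : ∀ n {f g : ℕ → ℕ} → (∀ j → j ≤ n → f j ≡ g j) → Σℕ[≤ n ] f ≡ Σℕ[≤ n ] g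
Σℕ-cong zero    f≗g = f≗g 0 z≤n
Σℕ-cong (suc n) f≗g =
  cong₂ _+ℕ_ (Σℕ-cong n (λ j j≤n → f≗g j (ℕP.m≤n⇒m≤1+n j≤n))) (f≗g (suc n) ℕP.≤-refl)

Σℕ-+ : ∀ n (f g : ℕ → ℕ) → Σℕ[≤ n ] (λ j → f j +ℕ g j) ≡ Σℕ[≤ n ] f +ℕ Σℕ[≤ n ] g
Σℕ-+ zero    f g = refl
Σℕ-+ (suc n) f g =
  trans (cong (_+ℕ (f (suc n) +ℕ g (suc n))) (Σℕ-+ n f g))
        (+-interchange (Σℕ[≤ n ] f) (Σℕ[≤ n ] g) (f (suc n)) (g (suc n)))

Σℕ-zero : ∀ n → Σℕ[≤ n ] (λ _ → 0) ≡ 0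
Σℕ-zero zero    = refl
Σℕ-zero (suc n) = cong (_+ℕ 0) (Σℕ-zero n)

Σℕ-split-head : ∀ n (f : ℕ → ℕ) → Σℕ[≤ suc n ] f ≡ f 0 +ℕ Σℕ[≤ n ] (λ j → f (suc j))
Σℕ-split-head zero    f = refl
Σℕ-split-head (suc n) f =
  trans (cong (_+ℕ f (suc (suc n))) (Σℕ-split-head n f))
        (ℕP.+-assoc (f 0) (Σℕ[≤ n ] (λ j → f (suc j))) (f (suc (suc n))))

-- The derivative of an EGF shifts its coefficient sequence.
D : (ℕ → ℕ) → ℕ → ℕ
D a j = a (suc j)

egf*-congˡ : ∀ {a a'} b n → (∀ i → a i ≡ a' i) → egf* a b n ≡ egf* a' b n
egf*-congˡ b n a≗a' = Σℕ-cong n (λ j _ → cong (λ x → (n C j) *ℕ (x *ℕ b (n ∸ j))) (a≗a' j))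

egf*-congʳ : ∀ a {b b'} n → (∀ i → b i ≡ b' i) → egf* a b n ≡ egf* a b' n
egf*-congʳ a n b≗b' = Σℕ-cong n (λ j _ → cong (λ x → (n C j) *ℕ (a j *ℕ x)) (b≗b' (n ∸ j)))

egf*-distribʳ : ∀ a a' b n → egf* (λ i → a i +ℕ a' i) b n ≡ egf* a b n +ℕ egf* a' b n
egf*-distribʳ a a' b n = trans
  (Σℕ-cong n (λ j _ → solve 4 (λ c x y z → c :* ((x :+ y) :* z) := c :* (x :* z) :+ c :* (y :* z))
                               refl (n C j) (a j) (a' j) (b (n ∸ j))))
  (Σℕ-+ n _ _)
  where open +-*-Solver

egf*-distribˡ : ∀ a b b' n → egf* a (λ i → b i +ℕ b' i) n ≡ egf* a b n +ℕ egf* a b' n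
egf*-distribˡ a b b' n = trans
  (Σℕ-cong n (λ j _ → solve 4 (λ c x y z → c :* (x :* (y :+ z)) := c :* (x :* y) :+ c :* (x :* z))
                               refl (n C j) (a j) (b (n ∸ j)) (b' (n ∸ j))))
  (Σℕ-+ n _ _)
  where open +-*-Solver

egf*-zeroʳ : ∀ a n → egf* a (λ _ → 0) n ≡ 0
egf*-zeroʳ a n = trans
  (Σℕ-cong n (λ j _ → trans (cong ((n C j) *ℕ_) (ℕP.*-zeroʳ (a j))) (ℕP.*-zeroʳ (n C j))))
  (Σℕ-zero n)

-- Leibniz rule D(a ⋆ b) = D a ⋆ b + a ⋆ D b, from Pascal's rule
-- C(n+1, j+1) = C(n, j) + C(n, j+1).
egf*-leibniz : ∀ a b n → egf* a b (suc n) ≡ egf* (D a) b n +ℕ egf* a (D b) n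
egf*-leibniz a b n = begin
    egf* a b (suc n)
  ≡⟨ Σℕ-split-head n h ⟩
    h 0 +ℕ Σℕ[≤ n ] (λ j → h (suc j))
  ≡⟨ cong (h 0 +ℕ_) (trans (Σℕ-cong n (λ j _ → pascal j)) (Σℕ-+ n _ _)) ⟩
    h 0 +ℕ (egf* (D a) b n +ℕ Σℕ[≤ n ] (λ j → g (suc j)))
  ≡⟨ +-x∙yz≈y∙xz (h 0) (egf* (D a) b n) _ ⟩
    egf* (D a) b n +ℕ (g 0 +ℕ Σℕ[≤ n ] (λ j → g (suc j)))
  ≡⟨ cong (egf* (D a) b n +ℕ_) (sym (Σℕ-split-head n g)) ⟩
    egf* (D a) b n +ℕ (Σℕ[≤ n ] g +ℕ g (suc n))
  ≡⟨ cong (λ t → egf* (D a) b n +ℕ (Σℕ[≤ n ] g +ℕ t)) last-vanishes ⟩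
    egf* (D a) b n +ℕ (Σℕ[≤ n ] g +ℕ 0)
  ≡⟨ cong (egf* (D a) b n +ℕ_) (ℕP.+-identityʳ _) ⟩
    egf* (D a) b n +ℕ Σℕ[≤ n ] g
  ≡⟨ cong (egf* (D a) b n +ℕ_) (Σℕ-cong n (λ j j≤n → cong (λ x → (n C j) *ℕ (a j *ℕ b x)) (ℕP.+-∸-assoc 1 j≤n))) ⟩
    egf* (D a) b n +ℕ egf* a (D b) n
  ∎
  where
  h g : ℕ → ℕ
  h j = (suc n C j) *ℕ (a j *ℕ b (suc n ∸ j))
  g j = (n C j) *ℕ (a j *ℕ b (suc n ∸ j))
  pascal : ∀ j → h (suc j) ≡ (n C j) *ℕ (a (suc j) *ℕ b (n ∸ j)) +ℕ g (suc j)
  pascal j = trans (cong (_*ℕ (a (suc j) *ℕ b (n ∸ j))) (sym (nCk+nC[k+1]≡[n+1]C[k+1] n j)))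
                   (ℕP.*-distribʳ-+ (a (suc j) *ℕ b (n ∸ j)) (n C j) (n C suc j))
  last-vanishes : g (suc n) ≡ 0
  last-vanishes = cong (_*ℕ (a (suc n) *ℕ b (n ∸ n))) (k>n⇒nCk≡0 (ℕP.n<1+n n))

-- Commutativity, unit and associativity, each by induction on the index
-- using the Leibniz rule.
egf*-comm : ∀ n a b → egf* a b n ≡ egf* b a n
egf*-comm zero    a b = cong (1 *ℕ_) (ℕP.*-comm (a 0) (b 0))
egf*-comm (suc n) a b = begin
    egf* a b (suc n)
  ≡⟨ egf*-leibniz a b n ⟩
    egf* (D a) b n +ℕ egf* a (D b) n
  ≡⟨ cong₂ _+ℕ_ (egf*-comm n (D a) b) (egf*-comm n a (D b)) ⟩
    egf* b (D a) n +ℕ egf* (D b) a n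
  ≡⟨ ℕP.+-comm (egf* b (D a) n) _ ⟩
    egf* (D b) a n +ℕ egf* b (D a) n
  ≡⟨ egf*-leibniz b a n ⟨
    egf* b a (suc n)
  ∎

egf*-identityʳ : ∀ n a → egf* a egf1 n ≡ a n
egf*-identityʳ zero    a = trans (ℕP.+-identityʳ _) (ℕP.*-identityʳ (a 0))
egf*-identityʳ (suc n) a =
  trans (egf*-leibniz a egf1 n)
        (trans (cong₂ _+ℕ_ (egf*-identityʳ n (D a)) (egf*-zeroʳ a n)) (ℕP.+-identityʳ _))

egf*-assoc : ∀ n a b c → egf* (egf* a b) c n ≡ egf* a (egf* b c) n
egf*-assoc zero a b c =
  solve 3 (λ x y z → con 1 :* ((con 1 :* (x :* y)) :* z) := con 1 :* (x :* (con 1 :* (y :* z))))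
        refl (a 0) (b 0) (c 0)
  where open +-*-Solver
egf*-assoc (suc n) a b c = begin
    egf* (egf* a b) c (suc n)
  ≡⟨ egf*-leibniz (egf* a b) c n ⟩
    egf* (D (egf* a b)) c n +ℕ egf* (egf* a b) (D c) n
  ≡⟨ cong (_+ℕ egf* (egf* a b) (D c) n)
          (trans (egf*-congˡ c n (egf*-leibniz a b)) (egf*-distribʳ (egf* (D a) b) (egf* a (D b)) c n)) ⟩
    (egf* (egf* (D a) b) c n +ℕ egf* (egf* a (D b)) c n) +ℕ egf* (egf* a b) (D c) n
  ≡⟨ cong₂ _+ℕ_ (cong₂ _+ℕ_ (egf*-assoc n (D a) b c) (egf*-assoc n a (D b) c)) (egf*-assoc n a b (D c)) ⟩
    (egf* (D a) (egf* b c) n +ℕ egf* a (egf* (D b) c) n) +ℕ egf* a (egf* b (D c)) n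
  ≡⟨ ℕP.+-assoc (egf* (D a) (egf* b c) n) _ _ ⟩
    egf* (D a) (egf* b c) n +ℕ (egf* a (egf* (D b) c) n +ℕ egf* a (egf* b (D c)) n)
  ≡⟨ cong (egf* (D a) (egf* b c) n +ℕ_)
          (trans (egf*-congʳ a n (egf*-leibniz b c)) (egf*-distribˡ a (egf* (D b) c) (egf* b (D c)) n)) ⟨
    egf* (D a) (egf* b c) n +ℕ egf* a (D (egf* b c)) n
  ≡⟨ egf*-leibniz a (egf* b c) n ⟨
    egf* a (egf* b c) (suc n)
  ∎

egf^-+ : ∀ a i m n → egf^ a (i +ℕ m) n ≡ egf* (egf^ a i) (egf^ a m) n
egf^-+ a zero    m n = sym (trans (egf*-comm n egf1 (egf^ a m)) (egf*-identityʳ n (egf^ a m)))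
egf^-+ a (suc i) m n = trans (egf*-congʳ a n (egf^-+ a i m)) (sym (egf*-assoc n a (egf^ a i) (egf^ a m)))

egf^-factor : ∀ A B r k ℓ n → ℓ ≤ r →
  egf* (egf^ A r) (egf^ B k) n ≡ egf* (egf* (egf^ A (r ∸ ℓ)) (egf^ B k)) (egf^ A ℓ) n
egf^-factor A B r k ℓ n ℓ≤r = begin
    egf* (egf^ A r) Bᵏ n
  ≡⟨ cong (λ t → egf* (egf^ A t) Bᵏ n) (sym (ℕP.m∸n+n≡m ℓ≤r)) ⟩
    egf* (egf^ A ((r ∸ ℓ) +ℕ ℓ)) Bᵏ n
  ≡⟨ egf*-congˡ Bᵏ n (egf^-+ A (r ∸ ℓ) ℓ) ⟩
    egf* (egf* P Q) Bᵏ n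
  ≡⟨ egf*-assoc n P Q Bᵏ ⟩
    egf* P (egf* Q Bᵏ) n
  ≡⟨ egf*-congʳ P n (λ i → egf*-comm i Q Bᵏ) ⟩
    egf* P (egf* Bᵏ Q) n
  ≡⟨ egf*-assoc n P Bᵏ Q ⟨
    egf* (egf* P Bᵏ) Q n
  ∎
  where
  P Q Bᵏ : ℕ → ℕ
  P = egf^ A (r ∸ ℓ)
  Q = egf^ A ℓ
  Bᵏ = egf^ B k

ι : ℕ → ℚ
ι = ℕ→ℚ

1/ℕ : (d : ℕ) → .{{NonZero d}} → ℚ
1/ℕ d = (+ 1) / d

-- Equalities in ℚ are checked on unnormalised representatives, where
-- a / (m+1) is represented by the pair (a, m).
toℚᵘ-/ : ∀ a m → toℚᵘ ((+ a) / suc m) ≃ᵘ mkℚᵘ (+ a) m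
toℚᵘ-/ a m = ℚP.toℚᵘ-fromℚᵘ (mkℚᵘ (+ a) m)

≡-viaᵘ : ∀ {p q : ℚ} {x y : ℚᵘ} → toℚᵘ p ≃ᵘ x → x ≃ᵘ y → toℚᵘ q ≃ᵘ y → p ≡ q
≡-viaᵘ p≃x x≃y q≃y = ℚP.toℚᵘ-injective (ℚᵘP.≃-trans p≃x (ℚᵘP.≃-trans x≃y (ℚᵘP.≃-sym q≃y)))

ι-+ : ∀ a b → ι (a +ℕ b) ≡ ι a +ℚ ι b
ι-+ a b = ≡-viaᵘ {y = mkℚᵘ (+ a) 0 +ᵘ mkℚᵘ (+ b) 0} (toℚᵘ-/ (a +ℕ b) 0)
  (*≡* (trans (cong (ℤ._* + 1) (ℤP.pos-+ a b))
              (solve 2 (λ x y → (x :+ y) :* con (+ 1) := (x :* con (+ 1) :+ y :* con (+ 1)) :* con (+ 1))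
                     refl (+ a) (+ b))))
  (ℚᵘP.≃-trans (ℚP.toℚᵘ-homo-+ (ι a) (ι b)) (ℚᵘP.+-cong (toℚᵘ-/ a 0) (toℚᵘ-/ b 0)))
  where open ℤSolver.+-*-Solver

ι-* : ∀ a b → ι (a *ℕ b) ≡ ι a * ι b
ι-* a b = ≡-viaᵘ {y = mkℚᵘ (+ a) 0 *ᵘ mkℚᵘ (+ b) 0} (toℚᵘ-/ (a *ℕ b) 0)
  (*≡* (cong (ℤ._* + 1) (ℤP.pos-* a b)))
  (ℚᵘP.≃-trans (ℚP.toℚᵘ-homo-* (ι a) (ι b)) (ℚᵘP.*-cong (toℚᵘ-/ a 0) (toℚᵘ-/ b 0)))

/-as-* : ∀ a d .{{_ : NonZero d}} → (+ a) / d ≡ ι a * 1/ℕ d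
/-as-* a zero    {{d≢0}} = ⊥-elim-irr (NonZero.nonZero d≢0)
/-as-* a (suc m) = ≡-viaᵘ {y = mkℚᵘ (+ a) 0 *ᵘ mkℚᵘ (+ 1) m} (toℚᵘ-/ a m)
  (*≡* (trans (cong (λ t → + a ℤ.* + t) (ℕP.*-identityˡ (suc m)))
              (solve 2 (λ x d → x :* d := (x :* con (+ 1)) :* d) refl (+ a) (+ suc m))))
  (ℚᵘP.≃-trans (ℚP.toℚᵘ-homo-* (ι a) (1/ℕ (suc m))) (ℚᵘP.*-cong (toℚᵘ-/ a 0) (toℚᵘ-/ 1 m)))
  where open ℤSolver.+-*-Solver

/-self : ∀ d .{{_ : NonZero d}} → (+ d) / d ≡ 1ℚ
/-self zero    {{d≢0}} = ⊥-elim-irr (NonZero.nonZero d≢0)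
/-self (suc m) = ≡-viaᵘ (toℚᵘ-/ (suc m) m) (*≡* (ℤP.*-comm (+ suc m) (+ 1))) (toℚᵘ-/ 1 0)

ι-*-1/ℕ : ∀ d .{{_ : NonZero d}} → ι d * 1/ℕ d ≡ 1ℚ
ι-*-1/ℕ d = trans (sym (/-as-* d d)) (/-self d)

Σℚ-cong : ∀ n {f g : ℕ → ℚ} → (∀ j → f j ≡ g j) → Σℚ[≤ n ] f ≡ Σℚ[≤ n ] g
Σℚ-cong zero    f≗g = f≗g 0
Σℚ-cong (suc n) f≗g = cong₂ _+ℚ_ (Σℚ-cong n f≗g) (f≗g (suc n))

Σℚ-*ʳ : ∀ n (f : ℕ → ℚ) c → Σℚ[≤ n ] (λ j → f j * c) ≡ Σℚ[≤ n ] f * c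
Σℚ-*ʳ zero    f c = refl
Σℚ-*ʳ (suc n) f c =
  trans (cong (_+ℚ f (suc n) * c) (Σℚ-*ʳ n f c)) (sym (ℚP.*-distribʳ-+ c (Σℚ[≤ n ] f) (f (suc n))))

ι-Σ : ∀ n f → ι (Σℕ[≤ n ] f) ≡ Σℚ[≤ n ] (λ j → ι (f j))
ι-Σ zero    f = refl
ι-Σ (suc n) f = trans (ι-+ (Σℕ[≤ n ] f) (f (suc n))) (cong (_+ℚ ι (f (suc n))) (ι-Σ n f))

ι-egf*-scaled : ∀ n a b (u v : ℚ) {p q : ℕ → ℚ} →
  (∀ j → p j ≡ ι (a j) * u) → (∀ m → q m ≡ ι (b m) * v) →
  Σℚ[≤ n ] (λ j → ι (n C j) * (p j * q (n ∸ j))) ≡ ι (egf* a b n) * (u * v)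
ι-egf*-scaled n a b u v {p} {q} p≗au q≗bv = begin
    Σℚ[≤ n ] (λ j → ι (n C j) * (p j * q (n ∸ j)))
  ≡⟨ Σℚ-cong n term ⟩
    Σℚ[≤ n ] (λ j → ι ((n C j) *ℕ (a j *ℕ b (n ∸ j))) * (u * v))
  ≡⟨ Σℚ-*ʳ n _ (u * v) ⟩
    Σℚ[≤ n ] (λ j → ι ((n C j) *ℕ (a j *ℕ b (n ∸ j)))) * (u * v)
  ≡⟨ cong (_* (u * v)) (ι-Σ n _) ⟨
    ι (egf* a b n) * (u * v)
  ∎
  where
  open ℚSolver.+-*-Solver
  regroup : ∀ c x y → c * ((x * u) * (y * v)) ≡ (c * (x * y)) * (u * v)
  regroup c x y = solve 5 (λ c x y u v → c :* ((x :* u) :* (y :* v)) := (c :* (x :* y)) :* (u :* v))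
                          refl c x y u v
  term : ∀ j → ι (n C j) * (p j * q (n ∸ j)) ≡ ι ((n C j) *ℕ (a j *ℕ b (n ∸ j))) * (u * v)
  term j = begin
      ι (n C j) * (p j * q (n ∸ j))
    ≡⟨ cong₂ (λ x y → ι (n C j) * (x * y)) (p≗au j) (q≗bv (n ∸ j)) ⟩
      ι (n C j) * ((ι (a j) * u) * (ι (b (n ∸ j)) * v))
    ≡⟨ regroup (ι (n C j)) (ι (a j)) (ι (b (n ∸ j))) ⟩
      (ι (n C j) * (ι (a j) * ι (b (n ∸ j)))) * (u * v)
    ≡⟨ cong (λ x → (ι (n C j) * x) * (u * v)) (ι-* (a j) (b (n ∸ j))) ⟨
      (ι (n C j) * ι (a j *ℕ b (n ∸ j))) * (u * v)
    ≡⟨ cong (_* (u * v)) (ι-* (n C j) (a j *ℕ b (n ∸ j))) ⟨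
      ι ((n C j) *ℕ (a j *ℕ b (n ∸ j))) * (u * v)
    ∎

1/fact : ℕ → ℚ
1/fact k = 1/ℕ (k !) {{k ℕP.!≢0}}

braceSr-cast : ∀ m k S r →
  braceSr m k S r ≡ ι (egf* (egf^ (egfSetShift S) r) (egf^ (egfSet S) k) m) * 1/fact k
braceSr-cast m k S r = /-as-* (egf* (egf^ (egfSetShift S) r) (egf^ (egfSet S) k) m) (k !) {{k ℕP.!≢0}}

braceT-cast : ∀ m ℓ T → braceT m ℓ T ≡ ι (egf^ (egfSet T) ℓ m) * 1/fact ℓ
braceT-cast m ℓ T = /-as-* (egf^ (egfSet T) ℓ m) (ℓ !) {{ℓ ℕP.!≢0}}

-- {m brace 0}_{S,ℓ} = ι (A^ℓ m), since B^0 is the unit EGF.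
braceSr-zero-cast : ∀ m S ℓ → braceSr m 0 S ℓ ≡ ι (egf^ (egfSetShift S) ℓ m) * 1ℚ
braceSr-zero-cast m S ℓ =
  trans (braceSr-cast m 0 S ℓ) (cong (λ x → ι x * 1ℚ) (egf*-identityʳ m (egf^ (egfSetShift S) ℓ)))

*-insert-inverse : ∀ x u c w → c * w ≡ 1ℚ → x * u ≡ c * (x * (u * w))
*-insert-inverse x u c w cw≡1 = begin
    x * u                  ≡⟨ ℚP.*-identityʳ (x * u) ⟨
    (x * u) * 1ℚ           ≡⟨ cong ((x * u) *_) cw≡1 ⟨
    (x * u) * (c * w)      ≡⟨ solve 4 (λ x u c w → (x :* u) :* (c :* w) := c :* (x :* (u :* w))) refl x u c w ⟩
    c * (x * (u * w))      ∎
  where open ℚSolver.+-*-Solver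

mainTheorem4 : (S : Subset) → S 0 ≡ false → (n k r ℓ : ℕ) → ℓ ≤ r →
    (braceSr n k S r
      ≡ ℕ→ℚ (ℓ !) * Σℚ[≤ n ] (λ j → ℕ→ℚ (n C j) * (braceSr j k S (r ∸ ℓ) * braceT (n ∸ j) ℓ (S -𝟙))))
    × (braceSr n k S r
      ≡ Σℚ[≤ n ] (λ j → ℕ→ℚ (n C j) * (braceSr j k S (r ∸ ℓ) * braceSr (n ∸ j) 0 S ℓ)))
mainTheorem4 S _ n k r ℓ ℓ≤r = with-S-1 , with-brace-0
  where
  A B Y Z : ℕ → ℕ
  A = egfSetShift S
  B = egfSet S
  Y = egf* (egf^ A (r ∸ ℓ)) (egf^ B k)
  Z = egf^ A ℓ
  factored : braceSr n k S r ≡ ι (egf* Y Z n) * 1/fact k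
  factored = trans (braceSr-cast n k S r) (cong (λ x → ι x * 1/fact k) (egf^-factor A B r k ℓ n ℓ≤r))
  with-S-1 : braceSr n k S r
    ≡ ι (ℓ !) * Σℚ[≤ n ] (λ j → ι (n C j) * (braceSr j k S (r ∸ ℓ) * braceT (n ∸ j) ℓ (S -𝟙)))
  with-S-1 = begin
      braceSr n k S r
    ≡⟨ factored ⟩
      ι (egf* Y Z n) * 1/fact k
    ≡⟨ *-insert-inverse (ι (egf* Y Z n)) (1/fact k) (ι (ℓ !)) (1/fact ℓ) (ι-*-1/ℕ (ℓ !) {{ℓ ℕP.!≢0}}) ⟩
      ι (ℓ !) * (ι (egf* Y Z n) * (1/fact k * 1/fact ℓ))
    ≡⟨ cong (ι (ℓ !) *_) (ι-egf*-scaled n Y Z _ _ (λ j → braceSr-cast j k S (r ∸ ℓ)) (λ m → braceT-cast m ℓ (S -𝟙))) ⟨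
      ι (ℓ !) * Σℚ[≤ n ] (λ j → ι (n C j) * (braceSr j k S (r ∸ ℓ) * braceT (n ∸ j) ℓ (S -𝟙)))
    ∎
  with-brace-0 : braceSr n k S r
    ≡ Σℚ[≤ n ] (λ j → ι (n C j) * (braceSr j k S (r ∸ ℓ) * braceSr (n ∸ j) 0 S ℓ))
  with-brace-0 = begin
      braceSr n k S r
    ≡⟨ factored ⟩
      ι (egf* Y Z n) * 1/fact k
    ≡⟨ cong (ι (egf* Y Z n) *_) (ℚP.*-identityʳ (1/fact k)) ⟨
      ι (egf* Y Z n) * (1/fact k * 1ℚ)
    ≡⟨ ι-egf*-scaled n Y Z _ _ (λ j → braceSr-cast j k S (r ∸ ℓ)) (λ m → braceSr-zero-cast m S ℓ) ⟨
      Σℚ[≤ n ] (λ j → ι (n C j) * (braceSr j k S (r ∸ ℓ) * braceSr (n ∸ j) 0 S ℓ))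
    ∎
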